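{- Let $(\mathcal{A},d)$ be a commutative differential ring without zero divisors (i.e. $d:\mathcal{A}\to\mathcal{A}$ is a derivation), and let $R=\ker(d)$ be its subring of constants. Let $z\in\mathcal{A}$ satisfy $d(z)=1$, and let $(e_\alpha)_{\alpha\in I}$, with $I\subset R$, be a family of elements of $\mathcal{A}$ such that $e_\alpha\neq 0$ and $d(e_\alpha)=\alpha e_\alpha$ for every $\alpha\in I$ (so the $e_\alpha$ are eigenfunctions of $d$ with pairwise distinct eigenvalues). Then the family $(e_\alpha)_{\alpha\in I}$ is linearly independent over $R[z]$.
   Context: $R[z]$ denotes the ring adjunction, i.e. the smallest subring of $\mathcal{A}$ generated by $R\cup\{z\}$. No assumption on the characteristic of $\mathcal{A}$ is made. -}

module Defs where

open import Level using (Level; _⊔_)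
open import Algebra.Bundles using (CommutativeRing)
open import Data.Nat using (ℕ)
import Data.Nat as ℕ
import Data.Fin as Fin
open import Data.Fin using (Fin)
open import Data.Sum using (_⊎_)
open import Relation.Nullary using (¬_)
open import Relation.Binary.PropositionalEquality using (_≡_)

module _ {c ℓ : Level} (A : CommutativeRing c ℓ) where
  open CommutativeRing A using (Carrier; _≈_; _+_; _*_; -_; 0#; 1#)

  record IsDerivation (d : Carrier → Carrier) : Set (c ⊔ ℓ) where
    field
      cong-d : ∀ {x y} → x ≈ y → d x ≈ d y
      d-+    : ∀ x y → d (x + y) ≈ d x + d y
      d-*    : ∀ x y → d (x * y) ≈ (d x * y) + (x * d y)

  NoZeroDivisors : Set (c ⊔ ℓ)
  NoZeroDivisors = ∀ x y → (x * y) ≈ 0# → (x ≈ 0#) ⊎ (y ≈ 0#)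

  IsConstant : (Carrier → Carrier) → Carrier → Set ℓ
  IsConstant d x = d x ≈ 0#

  -- membership in R[z]: the smallest subring of A containing R ∪ {z}
  -- (closed under ≈ since A's equality is a setoid equality)
  data InRz (d : Carrier → Carrier) (z : Carrier) : Carrier → Set (c ⊔ ℓ) where
    const : ∀ r → d r ≈ 0# → InRz d z r
    var   : InRz d z z
    add   : ∀ {x y} → InRz d z x → InRz d z y → InRz d z (x + y)
    mul   : ∀ {x y} → InRz d z x → InRz d z y → InRz d z (x * y)
    neg   : ∀ {x} → InRz d z x → InRz d z (- x)
    resp  : ∀ {x y} → x ≈ y → InRz d z x → InRz d z y

  sumFin : (n : ℕ) → (Fin n → Carrier) → Carrier
  sumFin ℕ.zero    f = 0#
  sumFin (ℕ.suc n) f = f Fin.zero + sumFin n (λ i → f (Fin.suc i))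

  LinIndepOverRz : {i : Level} (d : Carrier → Carrier) (z : Carrier)
                   (I : Carrier → Set i) (e : (α : Carrier) → I α → Carrier) →
                   Set (c ⊔ ℓ ⊔ i)
  LinIndepOverRz d z I e =
    ∀ (n : ℕ) (α : Fin n → Carrier) (α∈I : ∀ k → I (α k)) →
    (∀ j k → ¬ (j ≡ k) → ¬ (α j ≈ α k)) →
    (p : Fin n → Carrier) → (∀ k → InRz d z (p k)) →
    sumFin n (λ k → p k * e (α k) (α∈I k)) ≈ 0# →
    ∀ k → p k ≈ 0#

-- Every element of R[z] is killed by a power of d: constants and z are, and the
-- d-nilpotent elements form a subring by the Leibniz rule. For a constant c the
-- shifted operator d + c satisfies (d + c)(q e) = ((d + c + β) q) e whenever
-- d e = β e. Applying (d - α₀)ᴺ, with dᴺ p₀ = 0, to a relation Σ pₖ eₖ = 0 thus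
-- kills the first term and replaces every other pₖ by (d + αₖ - α₀)ᴺ pₖ ∈ R[z];
-- these vanish by induction on the length of the relation. Finally d + c is
-- injective on d-nilpotent elements when c ≠ 0: d q = -c q gives dᴹ q = (-c)ᴹ q,
-- so q = 0 since there are no zero divisors.
module Submission where

open import Defs
open import Level using (Level)
open import Algebra.Bundles using (CommutativeRing)
open import Relation.Binary.Bundles using (Setoid)
open import Data.Nat using (ℕ; zero; suc; _≤′_; ≤′-refl; ≤′-step)
import Data.Nat as ℕ
import Data.Nat.Properties as ℕ
open import Data.Nat.GeneralisedArithmetic using (iterate)
open import Data.Fin as Fin using (Fin)
open import Data.Fin.Properties using (suc-injective)
open import Data.Product using (∃; _,_)
open import Data.Sum using (inj₁; inj₂)
open import Data.Empty using (⊥-elim)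
open import Relation.Nullary using (¬_)
open import Relation.Binary.PropositionalEquality using (_≢_)
import Relation.Binary.PropositionalEquality as ≡

module _ {a ℓ} (S : Setoid a ℓ) where
  open Setoid S

  iterate-cong : ∀ {F G : Carrier → Carrier} → (∀ {x y} → x ≈ y → F x ≈ G y) →
                 ∀ n {x y} → x ≈ y → iterate F x n ≈ iterate G y n
  iterate-cong F≈G zero    x≈y = x≈y
  iterate-cong F≈G (suc n) x≈y = iterate-cong F≈G n (F≈G x≈y)

  iterate-comm : ∀ {F G : Carrier → Carrier} → (∀ {x y} → x ≈ y → G x ≈ G y) →
                 (∀ x → G (F x) ≈ F (G x)) → ∀ n x → iterate G (F x) n ≈ F (iterate G x n)
  iterate-comm G-cong GF≈FG zero    x = refl
  iterate-comm {G = G} G-cong GF≈FG (suc n) x =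
    trans (iterate-cong G-cong n (GF≈FG x)) (iterate-comm G-cong GF≈FG n (G x))

module _ {c ℓ} (A : CommutativeRing c ℓ) where
  open CommutativeRing A
  open import Algebra.Properties.Ring ring
    using (-0#≈0#; -‿involutive; -‿distribˡ-*; x+x≈x⇒x≈0; +-inverseˡ-unique; x∙y⁻¹≈ε⇒x≈y)
  open import Algebra.Properties.Semiring.Exp semiring using (_^_)
  open import Algebra.Properties.CommutativeSemigroup +-commutativeSemigroup
    using () renaming (interchange to +-interchange)
  open import Relation.Binary.Reasoning.Setoid setoid

  private
    zero-*ˡ : ∀ {x} y → x ≈ 0# → x * y ≈ 0#
    zero-*ˡ y x≈0 = trans (*-congʳ x≈0) (zeroˡ y)

  iterate-+ : ∀ {F : Carrier → Carrier} → (∀ {x y} → x ≈ y → F x ≈ F y) →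
              (∀ x y → F (x + y) ≈ F x + F y) →
              ∀ n x y → iterate F (x + y) n ≈ iterate F x n + iterate F y n
  iterate-+ F-cong F-+ zero    x y = refl
  iterate-+ {F} F-cong F-+ (suc n) x y =
    trans (iterate-cong setoid F-cong n (F-+ x y)) (iterate-+ F-cong F-+ n (F x) (F y))

  iterate-0# : ∀ {F : Carrier → Carrier} → (∀ {x y} → x ≈ y → F x ≈ F y) → F 0# ≈ 0# →
               ∀ n → iterate F 0# n ≈ 0#
  iterate-0# F-cong F0≈0 zero    = refl
  iterate-0# F-cong F0≈0 (suc n) = trans (iterate-cong setoid F-cong n F0≈0) (iterate-0# F-cong F0≈0 n)

  ^≈0⇒≈0 : NoZeroDivisors A → ∀ n {x} → x ^ n ≈ 0# → x ≈ 0#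
  ^≈0⇒≈0 noZeroDivisors zero {x} 1≈0 = begin
    x       ≈⟨ *-identityʳ x ⟨
    x * 1#  ≈⟨ *-congˡ 1≈0 ⟩
    x * 0#  ≈⟨ zeroʳ x ⟩
    0#      ∎
  ^≈0⇒≈0 noZeroDivisors (suc n) {x} xxⁿ≈0 with noZeroDivisors x (x ^ n) xxⁿ≈0
  ... | inj₁ x≈0  = x≈0
  ... | inj₂ xⁿ≈0 = ^≈0⇒≈0 noZeroDivisors n xⁿ≈0

  sumFin-cong : ∀ n {f g : Fin n → Carrier} → (∀ k → f k ≈ g k) → sumFin A n f ≈ sumFin A n g
  sumFin-cong zero    f≈g = refl
  sumFin-cong (suc n) f≈g = +-cong (f≈g Fin.zero) (sumFin-cong n (λ k → f≈g (Fin.suc k)))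

  sumFin-0# : ∀ n {f : Fin n → Carrier} → (∀ k → f k ≈ 0#) → sumFin A n f ≈ 0#
  sumFin-0# zero    f≈0 = refl
  sumFin-0# (suc n) f≈0 =
    trans (+-cong (f≈0 Fin.zero) (sumFin-0# n (λ k → f≈0 (Fin.suc k)))) (+-identityʳ 0#)

  sumFin-additive : ∀ {F : Carrier → Carrier} → F 0# ≈ 0# → (∀ x y → F (x + y) ≈ F x + F y) →
                    ∀ n f → F (sumFin A n f) ≈ sumFin A n (λ k → F (f k))
  sumFin-additive F0≈0 F-+ zero    f = F0≈0
  sumFin-additive F0≈0 F-+ (suc n) f =
    trans (F-+ _ _) (+-congˡ (sumFin-additive F0≈0 F-+ n (λ k → f (Fin.suc k))))

  module Derivation {d : Carrier → Carrier} (isDerivation : IsDerivation A d) where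
    open IsDerivation isDerivation

    d-0# : d 0# ≈ 0#
    d-0# = x+x≈x⇒x≈0 _ (trans (sym (d-+ 0# 0#)) (cong-d (+-identityˡ 0#)))

    d-1# : d 1# ≈ 0#
    d-1# = x+x≈x⇒x≈0 _ (begin
      d 1# + d 1#            ≈⟨ +-cong (*-identityʳ _) (*-identityˡ _) ⟨
      d 1# * 1# + 1# * d 1#  ≈⟨ d-* 1# 1# ⟨
      d (1# * 1#)            ≈⟨ cong-d (*-identityˡ 1#) ⟩
      d 1#                   ∎)

    d-neg : ∀ x → d (- x) ≈ - d x
    d-neg x = +-inverseˡ-unique (d (- x)) (d x) (begin
      d (- x) + d x  ≈⟨ d-+ (- x) x ⟨
      d (- x + x)    ≈⟨ cong-d (-‿inverseˡ x) ⟩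
      d 0#           ≈⟨ d-0# ⟩
      0#             ∎)

    d-*-constantˡ : ∀ {k} → IsConstant A d k → ∀ x → d (k * x) ≈ k * d x
    d-*-constantˡ {k} dk≈0 x = begin
      d (k * x)          ≈⟨ d-* k x ⟩
      d k * x + k * d x  ≈⟨ +-congʳ (zero-*ˡ x dk≈0) ⟩
      0# + k * d x       ≈⟨ +-identityˡ _ ⟩
      k * d x            ∎

    constant-neg : ∀ {a} → IsConstant A d a → IsConstant A d (- a)
    constant-neg da≈0 = trans (d-neg _) (trans (-‿cong da≈0) -0#≈0#)

    constant-difference : ∀ {a b} → IsConstant A d a → IsConstant A d b → IsConstant A d (a - b)
    constant-difference da≈0 db≈0 = trans (d-+ _ _) (trans (+-cong da≈0 (constant-neg db≈0)) (+-identityʳ 0#))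

    iterate-d-eigen : ∀ {α e} → IsConstant A d α → d e ≈ α * e → ∀ n → iterate d e n ≈ α ^ n * e
    iterate-d-eigen {α} {e} dα≈0 de≈αe zero    = sym (*-identityˡ e)
    iterate-d-eigen {α} {e} dα≈0 de≈αe (suc n) = begin
      iterate d (d e) n      ≈⟨ iterate-cong setoid cong-d n de≈αe ⟩
      iterate d (α * e) n    ≈⟨ iterate-comm setoid cong-d (d-*-constantˡ dα≈0) n e ⟩
      α * iterate d e n      ≈⟨ *-congˡ (iterate-d-eigen dα≈0 de≈αe n) ⟩
      α * (α ^ n * e)        ≈⟨ *-assoc α (α ^ n) e ⟨
      α * α ^ n * e          ∎

    Nilpotent : ℕ → Carrier → Set ℓ
    Nilpotent n x = iterate d x n ≈ 0#

    nilpotent-resp : ∀ n {x y} → x ≈ y → Nilpotent n x → Nilpotent n y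
    nilpotent-resp n x≈y dⁿx≈0 = trans (iterate-cong setoid cong-d n (sym x≈y)) dⁿx≈0

    ≈0⇒nilpotent : ∀ n {x} → x ≈ 0# → Nilpotent n x
    ≈0⇒nilpotent n x≈0 = nilpotent-resp n (sym x≈0) (iterate-0# cong-d d-0# n)

    nilpotent-suc : ∀ n {x} → Nilpotent n x → Nilpotent (suc n) x
    nilpotent-suc n {x} dⁿx≈0 =
      trans (iterate-comm setoid {F = d} cong-d (λ _ → refl) n x) (trans (cong-d dⁿx≈0) d-0#)

    nilpotent-mono : ∀ {m n x} → m ≤′ n → Nilpotent m x → Nilpotent n x
    nilpotent-mono ≤′-refl           dᵐx≈0 = dᵐx≈0
    nilpotent-mono (≤′-step {n} m≤n) dᵐx≈0 = nilpotent-suc n (nilpotent-mono m≤n dᵐx≈0)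

    nilpotent-+ : ∀ m n {x y} → Nilpotent m x → Nilpotent n y → Nilpotent (m ℕ.+ n) (x + y)
    nilpotent-+ m n {x} {y} dᵐx≈0 dⁿy≈0 = begin
      iterate d (x + y) (m ℕ.+ n)                    ≈⟨ iterate-+ cong-d d-+ (m ℕ.+ n) x y ⟩
      iterate d x (m ℕ.+ n) + iterate d y (m ℕ.+ n)  ≈⟨ +-cong (nilpotent-mono (ℕ.m≤′m+n m n) dᵐx≈0)
                                                               (nilpotent-mono (ℕ.n≤′m+n m n) dⁿy≈0) ⟩
      0# + 0#                                        ≈⟨ +-identityʳ 0# ⟩
      0#                                             ∎

    nilpotent-* : ∀ m n {x y} → Nilpotent m x → Nilpotent n y → Nilpotent (m ℕ.+ n) (x * y)
    nilpotent-* zero    n       {x} {y} x≈0   _   = ≈0⇒nilpotent n (zero-*ˡ y x≈0)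
    nilpotent-* (suc m) zero    {x} {y} _     y≈0 =
      ≈0⇒nilpotent (suc m ℕ.+ 0) (trans (*-comm x y) (zero-*ˡ x y≈0))
    nilpotent-* (suc m) (suc n) {x} {y} dᵐ⁺¹x≈0 dⁿ⁺¹y≈0 = begin
      iterate d (d (x * y)) (m ℕ.+ suc n)                  ≈⟨ iterate-cong setoid cong-d (m ℕ.+ suc n) (d-* x y) ⟩
      iterate d (d x * y + x * d y) (m ℕ.+ suc n)          ≈⟨ iterate-+ cong-d d-+ (m ℕ.+ suc n) _ _ ⟩
      iterate d (d x * y) (m ℕ.+ suc n) + iterate d (x * d y) (m ℕ.+ suc n)
        ≈⟨ +-cong (nilpotent-* m (suc n) dᵐ⁺¹x≈0 dⁿ⁺¹y≈0)
                  (≡.subst (λ k → Nilpotent k (x * d y)) (≡.sym (ℕ.+-suc m n))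
                         (nilpotent-* (suc m) n dᵐ⁺¹x≈0 dⁿ⁺¹y≈0)) ⟩
      0# + 0#                                            ≈⟨ +-identityʳ 0# ⟩
      0#                                                 ∎

    nilpotent-neg : ∀ n {x} → Nilpotent n x → Nilpotent n (- x)
    nilpotent-neg n {x} dⁿx≈0 =
      trans (iterate-comm setoid cong-d d-neg n x) (trans (-‿cong dⁿx≈0) -0#≈0#)

    nilpotent-eigen≈0 : NoZeroDivisors A → ∀ n {α e} → IsConstant A d α → ¬ α ≈ 0# →
                        d e ≈ α * e → Nilpotent n e → e ≈ 0#
    nilpotent-eigen≈0 noZeroDivisors n {α} {e} dα≈0 α≉0 de≈αe dⁿe≈0
      with noZeroDivisors (α ^ n) e (trans (sym (iterate-d-eigen dα≈0 de≈αe n)) dⁿe≈0)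
    ... | inj₁ αⁿ≈0 = ⊥-elim (α≉0 (^≈0⇒≈0 noZeroDivisors n αⁿ≈0))
    ... | inj₂ e≈0  = e≈0

    shifted : Carrier → Carrier → Carrier
    shifted c x = d x + c * x

    shifted-cong : ∀ {c c′ x y} → c ≈ c′ → x ≈ y → shifted c x ≈ shifted c′ y
    shifted-cong c≈c′ x≈y = +-cong (cong-d x≈y) (*-cong c≈c′ x≈y)

    shifted-0# : ∀ c → shifted c 0# ≈ 0#
    shifted-0# c = trans (+-cong d-0# (zeroʳ c)) (+-identityʳ 0#)

    shifted-+ : ∀ c x y → shifted c (x + y) ≈ shifted c x + shifted c y
    shifted-+ c x y = trans (+-cong (d-+ x y) (distribˡ c x y)) (+-interchange (d x) (d y) (c * x) (c * y))

    shifted-*-eigen : ∀ c {β e} → d e ≈ β * e → ∀ q → shifted c (q * e) ≈ shifted (β + c) q * e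
    shifted-*-eigen c {β} {e} de≈βe q = begin
      d (q * e) + c * (q * e)              ≈⟨ +-congʳ (trans (d-* q e) (+-congˡ (*-congˡ de≈βe))) ⟩
      (d q * e + q * (β * e)) + c * (q * e) ≈⟨ +-assoc _ _ _ ⟩
      d q * e + (q * (β * e) + c * (q * e)) ≈⟨ +-congˡ (+-cong βqe≈qβe (*-assoc c q e)) ⟨
      d q * e + (β * q * e + c * q * e)     ≈⟨ +-congˡ (distribʳ e (β * q) (c * q)) ⟨
      d q * e + (β * q + c * q) * e         ≈⟨ +-congˡ (*-congʳ (distribʳ q β c)) ⟨
      d q * e + (β + c) * q * e             ≈⟨ distribʳ e (d q) _ ⟨
      shifted (β + c) q * e                 ∎
      where
      βqe≈qβe : β * q * e ≈ q * (β * e)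
      βqe≈qβe = trans (*-congʳ (*-comm β q)) (*-assoc q β e)

    iterate-shifted-0# : ∀ {c} → c ≈ 0# → ∀ n x → iterate (shifted c) x n ≈ iterate d x n
    iterate-shifted-0# {c} c≈0 n x = iterate-cong setoid (λ {x} {y} x≈y → begin
      d x + c * x  ≈⟨ +-cong (cong-d x≈y) (zero-*ˡ x c≈0) ⟩
      d y + 0#     ≈⟨ +-identityʳ (d y) ⟩
      d y          ∎) n refl

    shifted-nilpotent-injective : NoZeroDivisors A → ∀ n {c q} → IsConstant A d c → ¬ c ≈ 0# →
                                  Nilpotent n q → shifted c q ≈ 0# → q ≈ 0#
    shifted-nilpotent-injective noZeroDivisors n {c} {q} dc≈0 c≉0 dⁿq≈0 [d+c]q≈0 =
      nilpotent-eigen≈0 noZeroDivisors n (constant-neg dc≈0) -c≉0 dq≈-cq dⁿq≈0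
      where
      dq≈-cq : d q ≈ - c * q
      dq≈-cq = trans (+-inverseˡ-unique (d q) (c * q) [d+c]q≈0) (-‿distribˡ-* c q)
      -c≉0 : ¬ - c ≈ 0#
      -c≉0 -c≈0 = c≉0 (trans (sym (-‿involutive c)) (trans (-‿cong -c≈0) -0#≈0#))

    iterate-shifted-sumFin : ∀ n {β e : Fin n → Carrier} → (∀ k → d (e k) ≈ β k * e k) →
                             ∀ c N (p : Fin n → Carrier) → sumFin A n (λ k → p k * e k) ≈ 0# →
                             sumFin A n (λ k → iterate (shifted (β k + c)) (p k) N * e k) ≈ 0#
    iterate-shifted-sumFin n                 e-eigen c zero    p Σpe≈0 = Σpe≈0
    iterate-shifted-sumFin n {β} {e} e-eigen c (suc N) p Σpe≈0 =
      iterate-shifted-sumFin n e-eigen c N (λ k → shifted (β k + c) (p k)) (begin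
        sumFin A n (λ k → shifted (β k + c) (p k) * e k)
          ≈⟨ sumFin-cong n (λ k → shifted-*-eigen c (e-eigen k) (p k)) ⟨
        sumFin A n (λ k → shifted c (p k * e k))
          ≈⟨ sumFin-additive (shifted-0# c) (shifted-+ c) n _ ⟨
        shifted c (sumFin A n (λ k → p k * e k))
          ≈⟨ shifted-cong refl Σpe≈0 ⟩
        shifted c 0#
          ≈⟨ shifted-0# c ⟩
        0# ∎)

    module Polynomials {z : Carrier} (dz≈1 : d z ≈ 1#) where

      InRz-nilpotent : ∀ {x} → InRz A d z x → ∃ λ n → Nilpotent n x
      InRz-nilpotent (const r dr≈0) = 1 , dr≈0
      InRz-nilpotent var            = 2 , trans (cong-d dz≈1) d-1#
      InRz-nilpotent (add x∈ y∈) with InRz-nilpotent x∈ | InRz-nilpotent y∈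
      ... | m , dᵐx≈0 | n , dⁿy≈0 = m ℕ.+ n , nilpotent-+ m n dᵐx≈0 dⁿy≈0
      InRz-nilpotent (mul x∈ y∈) with InRz-nilpotent x∈ | InRz-nilpotent y∈
      ... | m , dᵐx≈0 | n , dⁿy≈0 = m ℕ.+ n , nilpotent-* m n dᵐx≈0 dⁿy≈0
      InRz-nilpotent (neg x∈) with InRz-nilpotent x∈
      ... | n , dⁿx≈0 = n , nilpotent-neg n dⁿx≈0
      InRz-nilpotent (resp x≈y x∈) with InRz-nilpotent x∈
      ... | n , dⁿx≈0 = n , nilpotent-resp n x≈y dⁿx≈0

      InRz-d : ∀ {x} → InRz A d z x → InRz A d z (d x)
      InRz-d (const r dr≈0) = resp (sym dr≈0) (const 0# d-0#)
      InRz-d var            = resp (sym dz≈1) (const 1# d-1#)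
      InRz-d (add x∈ y∈)    = resp (sym (d-+ _ _)) (add (InRz-d x∈) (InRz-d y∈))
      InRz-d (mul x∈ y∈)    = resp (sym (d-* _ _)) (add (mul (InRz-d x∈) y∈) (mul x∈ (InRz-d y∈)))
      InRz-d (neg x∈)       = resp (sym (d-neg _)) (neg (InRz-d x∈))
      InRz-d (resp x≈y x∈)  = resp (cong-d x≈y) (InRz-d x∈)

      InRz-shifted : ∀ {c x} → IsConstant A d c → InRz A d z x → InRz A d z (shifted c x)
      InRz-shifted dc≈0 x∈ = add (InRz-d x∈) (mul (const _ dc≈0) x∈)

      InRz-iterate-shifted : ∀ {c} → IsConstant A d c → ∀ n {x} → InRz A d z x →
                             InRz A d z (iterate (shifted c) x n)
      InRz-iterate-shifted dc≈0 zero    x∈ = x∈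
      InRz-iterate-shifted dc≈0 (suc n) x∈ = InRz-iterate-shifted dc≈0 n (InRz-shifted dc≈0 x∈)

      iterate-shifted-InRz-injective : NoZeroDivisors A → ∀ {c} → IsConstant A d c → ¬ c ≈ 0# →
                                       ∀ n {q} → InRz A d z q → iterate (shifted c) q n ≈ 0# → q ≈ 0#
      iterate-shifted-InRz-injective noZeroDivisors dc≈0 c≉0 zero    q∈ q≈0 = q≈0
      iterate-shifted-InRz-injective noZeroDivisors dc≈0 c≉0 (suc n) q∈ [d+c]ⁿ⁺¹q≈0
        with InRz-nilpotent q∈
      ... | m , dᵐq≈0 =
        shifted-nilpotent-injective noZeroDivisors m dc≈0 c≉0 dᵐq≈0
          (iterate-shifted-InRz-injective noZeroDivisors dc≈0 c≉0 n (InRz-shifted dc≈0 q∈) [d+c]ⁿ⁺¹q≈0)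

      eigenvectors-independent :
        NoZeroDivisors A → ∀ n (α e : Fin n → Carrier) →
        (∀ k → IsConstant A d (α k)) → (∀ j k → j ≢ k → ¬ α j ≈ α k) →
        (∀ k → ¬ e k ≈ 0#) → (∀ k → d (e k) ≈ α k * e k) →
        (p : Fin n → Carrier) → (∀ k → InRz A d z (p k)) →
        sumFin A n (λ k → p k * e k) ≈ 0# → ∀ k → p k ≈ 0#
      eigenvectors-independent noZeroDivisors zero _ _ _ _ _ _ _ _ _ ()
      eigenvectors-independent noZeroDivisors (suc n) α e α-constant α-distinct e≉0 e-eigen p p∈Rz Σpe≈0
        with InRz-nilpotent (p∈Rz Fin.zero)
      ... | N , dᴺp₀≈0 = p≈0
        where
        q : Fin (suc n) → Carrier
        q k = iterate (shifted (α k - α Fin.zero)) (p k) N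

        Σqe≈0 : q Fin.zero * e Fin.zero + sumFin A n (λ k → q (Fin.suc k) * e (Fin.suc k)) ≈ 0#
        Σqe≈0 = iterate-shifted-sumFin (suc n) e-eigen (- α Fin.zero) N p Σpe≈0

        q₀≈0 : q Fin.zero ≈ 0#
        q₀≈0 = trans (iterate-shifted-0# (-‿inverseʳ (α Fin.zero)) N (p Fin.zero)) dᴺp₀≈0

        α-shift-constant : ∀ k → IsConstant A d (α k - α Fin.zero)
        α-shift-constant k = constant-difference (α-constant k) (α-constant Fin.zero)

        α-shift≉0 : ∀ k → ¬ α (Fin.suc k) - α Fin.zero ≈ 0#
        α-shift≉0 k αₖ-α₀≈0 = α-distinct (Fin.suc k) Fin.zero (λ ()) (x∙y⁻¹≈ε⇒x≈y _ _ αₖ-α₀≈0)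

        q-tail≈0 : ∀ k → q (Fin.suc k) ≈ 0#
        q-tail≈0 = eigenvectors-independent noZeroDivisors n
          (λ k → α (Fin.suc k)) (λ k → e (Fin.suc k)) (λ k → α-constant (Fin.suc k))
          (λ j k j≢k → α-distinct (Fin.suc j) (Fin.suc k) (λ sj≡sk → j≢k (suc-injective sj≡sk)))
          (λ k → e≉0 (Fin.suc k)) (λ k → e-eigen (Fin.suc k))
          (λ k → q (Fin.suc k)) (λ k → InRz-iterate-shifted (α-shift-constant (Fin.suc k)) N (p∈Rz (Fin.suc k)))
          (trans (sym (+-identityˡ _)) (trans (+-congʳ (sym (zero-*ˡ _ q₀≈0))) Σqe≈0))

        p-tail≈0 : ∀ k → p (Fin.suc k) ≈ 0#
        p-tail≈0 k = iterate-shifted-InRz-injective noZeroDivisors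
          (α-shift-constant (Fin.suc k)) (α-shift≉0 k) N (p∈Rz (Fin.suc k)) (q-tail≈0 k)

        p₀e₀≈0 : p Fin.zero * e Fin.zero ≈ 0#
        p₀e₀≈0 = trans (sym (+-identityʳ _))
          (trans (+-congˡ (sym (sumFin-0# n (λ k → zero-*ˡ _ (p-tail≈0 k))))) Σpe≈0)

        p≈0 : ∀ k → p k ≈ 0#
        p≈0 (Fin.suc k) = p-tail≈0 k
        p≈0 Fin.zero with noZeroDivisors _ _ p₀e₀≈0
        ... | inj₁ p₀≈0 = p₀≈0
        ... | inj₂ e₀≈0 = ⊥-elim (e≉0 Fin.zero e₀≈0)

lemma1 : {c ℓ i : Level} (A : CommutativeRing c ℓ) →
    let open CommutativeRing A in
    (d : Carrier → Carrier) → IsDerivation A d → NoZeroDivisors A →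
    (z : Carrier) → d z ≈ 1# →
    (I : Carrier → Set i) → (∀ α → I α → IsConstant A d α) →
    (e : (α : Carrier) → I α → Carrier) →
    (∀ α (h : I α) → ¬ (e α h ≈ 0#)) →
    (∀ α (h : I α) → d (e α h) ≈ α * e α h) →
    LinIndepOverRz A d z I e
lemma1 A d isDerivation noZeroDivisors z dz≈1 I I-constant e e≉0 e-eigen n α α∈I α-distinct =
  eigenvectors-independent noZeroDivisors n α (λ k → e (α k) (α∈I k))
    (λ k → I-constant (α k) (α∈I k)) α-distinct
    (λ k → e≉0 (α k) (α∈I k)) (λ k → e-eigen (α k) (α∈I k))
  where open Derivation A isDerivation
        open Polynomials dz≈1
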